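{- Let $R,C$ be positive integers, ${\cal I}=\{(i,j)\mid 1\le i\le R,\ 1\le j\le C\}$ and let $S$ be a nonempty proper subset of ${\cal I}$ that is equivalent to a $2\times2$ block diagonal set. Then ${\cal B}_0(S)$ is a Markov basis for $S$.
   Context: $S$ is equivalent to a $2\times2$ block diagonal set if, after some permutation of the rows and some permutation of the columns, $S=\{(i,j)\mid i\le r,\ j\le c\}\cup\{(i,j)\mid i>r,\ j>c\}$ for some integers $0\le r<R$, $0\le c<C$. A table is an array on ${\cal I}$ with entries in $\mathbb{N}=\{0,1,2,\dots\}$; the fiber of a table $X$ is the set of tables with the same row sums, column sums and sum of entries over $S$. A move for $S$ is an integer array on ${\cal I}$ with all row and column sums $0$ and entries over $S$ summing to $0$. A Markov basis for $S$ is a finite set ${\cal B}$ of moves for $S$, closed under negation, such that for every fiber ${\cal F}$ and all $X,Y\in{\cal F}$ there exist $\alpha\ge1$ and $B_1,\dots,B_\alpha\in{\cal B}$ with $Y=X+\sum_{s=1}^\alpha B_s$ and $X+\sum_{s=1}^a B_s\in{\cal F}$ for $1\le a\le\alpha$. For $i\ne i'$, $j\ne j'$, the basic move $B(i,i';j,j')$ has $+1$ at $(i,j),(i',j')$, $-1$ at $(i,j'),(i',j)$, $0$ elsewhere; ${\cal B}_0(S)$ is the set of basic moves that are moves for $S$. -}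

module Defs where

open import Data.Nat using (ℕ; zero; suc; _<_; _≥_)
open import Data.Integer using (ℤ; +_; _+_; -_; 0ℤ; 1ℤ; -1ℤ)
open import Data.Fin using (Fin; toℕ)
open import Data.Fin.Permutation using (Permutation′; _⟨$⟩ʳ_)
open import Data.Bool using (Bool; true; false; if_then_else_)
open import Data.List using (List; []; _∷_; length; take)
open import Data.List.Relation.Unary.All using (All)
open import Data.List.Relation.Unary.Any using (Any)
open import Data.Product using (Σ; ∃; _×_; _,_)
open import Data.Sum using (_⊎_)
open import Relation.Binary.PropositionalEquality using (_≡_; _≢_)
open import Relation.Nullary using (¬_)
open import Function.Bundles using (_⇔_)
open import Data.Fin using (_≟_)
open import Relation.Nullary.Decidable using (⌊_⌋)
open import Data.Bool using (_∧_)

Σℤ : ∀ {n} → (Fin n → ℤ) → ℤ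
Σℤ {zero}  f = 0ℤ
Σℤ {suc n} f = f Fin.zero + Σℤ (λ k → f (Fin.suc k))
  where import Data.Fin as Fin

-- A subset S of I = [R] × [C], as a decidable predicate (indices 0-based).
Subset : ℕ → ℕ → Set
Subset R C = Fin R → Fin C → Bool

_∈S_ : ∀ {R C} → Fin R × Fin C → Subset R C → Set
(i , j) ∈S S = S i j ≡ true

Nonempty : ∀ {R C} → Subset R C → Set
Nonempty {R} {C} S = ∃ λ (p : Fin R × Fin C) → p ∈S S

Proper : ∀ {R C} → Subset R C → Set
Proper {R} {C} S = ∃ λ (p : Fin R × Fin C) → ¬ (p ∈S S)

-- S is equivalent to a 2x2 block diagonal set: after permuting rows by σ and
-- columns by τ, S = {(i,j) | i ≤ r, j ≤ c} ∪ {(i,j) | i > r, j > c}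
-- (1-based; with 0-based Fin indices "i ≤ r" reads "toℕ i < r").
Block2x2 : ∀ {R C} → Subset R C → Set
Block2x2 {R} {C} S =
  Σ ℕ λ r → Σ ℕ λ c → r < R × c < C ×
  Σ (Permutation′ R) λ σ → Σ (Permutation′ C) λ τ →
  ∀ (i : Fin R) (j : Fin C) →
    ((σ ⟨$⟩ʳ i , τ ⟨$⟩ʳ j) ∈S S) ⇔
    ((toℕ i < r × toℕ j < c) ⊎ (toℕ i ≥ r × toℕ j ≥ c))

Table : ℕ → ℕ → Set
Table R C = Fin R → Fin C → ℕ

Array : ℕ → ℕ → Set
Array R C = Fin R → Fin C → ℤ

toArray : ∀ {R C} → Table R C → Array R C
toArray X i j = + (X i j)

rowSum : ∀ {R C} → Array R C → Fin R → ℤ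
rowSum A i = Σℤ (λ j → A i j)

colSum : ∀ {R C} → Array R C → Fin C → ℤ
colSum A j = Σℤ (λ i → A i j)

sumOver : ∀ {R C} → Subset R C → Array R C → ℤ
sumOver S A = Σℤ (λ i → Σℤ (λ j → if S i j then A i j else 0ℤ))

SameFiber : ∀ {R C} → Subset R C → Table R C → Table R C → Set
SameFiber S X Y =
  (∀ i → rowSum (toArray X) i ≡ rowSum (toArray Y) i) ×
  (∀ j → colSum (toArray X) j ≡ colSum (toArray Y) j) ×
  sumOver S (toArray X) ≡ sumOver S (toArray Y)

IsMove : ∀ {R C} → Subset R C → Array R C → Set
IsMove S B =
  (∀ i → rowSum B i ≡ 0ℤ) × (∀ j → colSum B j ≡ 0ℤ) × sumOver S B ≡ 0ℤ

_⊕_ : ∀ {R C} → Array R C → Array R C → Array R C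
(A ⊕ B) i j = A i j + B i j

negA : ∀ {R C} → Array R C → Array R C
negA A i j = - A i j

zeroA : ∀ {R C} → Array R C
zeroA i j = 0ℤ

sumMoves : ∀ {R C} → List (Array R C) → Array R C
sumMoves []       = zeroA
sumMoves (B ∷ Bs) = B ⊕ sumMoves Bs

_≋_ : ∀ {R C} → Array R C → Array R C → Set
A ≋ B = ∀ i j → A i j ≡ B i j

ArraySet : ℕ → ℕ → Set₁
ArraySet R C = Array R C → Set

FiniteSet : ∀ {R C} → ArraySet R C → Set
FiniteSet {R} {C} 𝓑 =
  Σ (List (Array R C)) λ L → ∀ B → 𝓑 B → Any (λ B′ → B ≋ B′) L

-- Y is reachable from X by moves of 𝓑 staying in the fiber of X.
Connects : ∀ {R C} → Subset R C → ArraySet R C → Table R C → Table R C → Set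
Connects {R} {C} S 𝓑 X Y =
  Σ (List (Array R C)) λ Bs →
    All 𝓑 Bs ×
    (∀ (a : ℕ) → a Data.Nat.≤ length Bs →
       Σ (Table R C) λ Z →
         (toArray Z ≋ (toArray X ⊕ sumMoves (take a Bs))) × SameFiber S X Z) ×
    (toArray Y ≋ (toArray X ⊕ sumMoves Bs))
  where import Data.Nat

MarkovBasis : ∀ {R C} → Subset R C → ArraySet R C → Set
MarkovBasis {R} {C} S 𝓑 =
  FiniteSet 𝓑 ×
  (∀ B → 𝓑 B → IsMove S B) ×
  (∀ B → 𝓑 B → 𝓑 (negA B)) ×
  (∀ (X Y : Table R C) → SameFiber S X Y → Connects S 𝓑 X Y)

basicMove : ∀ {R C} → Fin R → Fin R → Fin C → Fin C → Array R C
basicMove i i′ j j′ k l =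
  (if ⌊ k ≟ i ⌋ ∧ ⌊ l ≟ j ⌋ then 1ℤ else 0ℤ) +
  (if ⌊ k ≟ i′ ⌋ ∧ ⌊ l ≟ j′ ⌋ then 1ℤ else 0ℤ) +
  (if ⌊ k ≟ i ⌋ ∧ ⌊ l ≟ j′ ⌋ then -1ℤ else 0ℤ) +
  (if ⌊ k ≟ i′ ⌋ ∧ ⌊ l ≟ j ⌋ then -1ℤ else 0ℤ)

B₀ : ∀ {R C} → Subset R C → ArraySet R C
B₀ {R} {C} S B =
  (Σ (Fin R) λ i → Σ (Fin R) λ i′ → Σ (Fin C) λ j → Σ (Fin C) λ j′ →
     i ≢ i′ × j ≢ j′ × B ≋ basicMove i i′ j j′) ×
  IsMove S B

-- Relabel rows and columns by the diagonal block they belong to, so that S is the set of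
-- cells whose row side and column side agree. For X, Y in one fiber, D = X − Y has zero row
-- sums, zero column sums and zero sum over S, which together force all four block sums of D
-- to vanish. A basic move whose two rows, or two columns, lie on one side is a move for S.
-- Measure D by the ℓ¹ norm of its row imbalances (row sums over one column side), of its
-- column imbalances, and of its entries. If some row imbalance is nonzero, the vanishing block
-- sums give two rows on one side with imbalances of opposite sign, and a basic move between
-- them lowers the row imbalances while keeping the column ones; columns are symmetric. If all
-- imbalances vanish, a negative entry of D can be cancelled inside its row side and its
-- column side, lowering the entrywise norm. These moves subtract only where D, hence X, is
-- positive, so every step stays in the fiber, and descent on the potential reaches Y.

module Submission where

open import Defs
open import Data.Bool using (Bool; true; false; not; if_then_else_; _∧_)
open import Data.Bool.Properties using (¬-not; not-¬)
open import Data.Empty using (⊥-elim)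
open import Data.Fin using (Fin; _≟_; toℕ) renaming (zero to fzero; suc to fsuc)
open import Data.Fin.Permutation using (_⟨$⟩ʳ_; _⟨$⟩ˡ_; inverseʳ)
open import Data.Fin.Properties using (any?; all?; ¬∀⟶∃¬)
open import Data.Integer
  using (ℤ; +_; _+_; _-_; -_; _*_; 0ℤ; 1ℤ; -1ℤ; _≤_; _<_; ∣_∣; +≤+; +<+; -[1+_]; +[1+_]; +0)
open import Data.Integer.Properties hiding (_≟_)
open import Data.Integer.Properties using () renaming (_≟_ to _≟ℤ_)
open import Data.Integer.Tactic.RingSolver using (solve-∀)
open import Data.Nat using (ℕ; zero; suc; z≤n; s≤s; s≤s⁻¹; NonZero)
import Data.Nat as ℕ
import Data.Nat.Properties as ℕₚ
open import Data.Product using (Σ; ∃; ∃₂; _×_; _,_; proj₁; proj₂; map₁)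
open import Data.List using ([]; _∷_; length; take; map; cartesianProduct; allFin)
open import Data.List.Relation.Unary.All using ([]; _∷_)
import Data.List.Relation.Unary.Any as Any
open import Data.List.Membership.Propositional.Properties
  using (∈-map⁺; ∈-cartesianProduct⁺; ∈-allFin)
open import Data.Sum using (_⊎_; inj₁; inj₂; [_,_]′)
open import Function.Bundles using (_⇔_; Equivalence)
open import Function using (_∘_)
open import Relation.Binary.PropositionalEquality
open import Relation.Nullary using (yes; no; does)
open import Relation.Binary.Definitions using (tri<; tri≈; tri>)
open import Relation.Nullary.Decidable using (⌊_⌋; isYes≗does)

open import Algebra.Properties.Semiring.Sum +-*-semiring
  using (sum; sum-replicate-zero; ∑-distrib-+; ∑-comm; *-distribˡ-sum)

private variable
  m n R C : ℕ

-- Finite sums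

Σℤ≡sum : (f : Fin n → ℤ) → Σℤ f ≡ sum f
Σℤ≡sum {zero}  f = refl
Σℤ≡sum {suc n} f = cong (_+_ (f fzero)) (Σℤ≡sum (f ∘ fsuc))

Σℤ-cong : {f g : Fin n → ℤ} → (∀ k → f k ≡ g k) → Σℤ f ≡ Σℤ g
Σℤ-cong {zero}  f≗g = refl
Σℤ-cong {suc n} f≗g = cong₂ _+_ (f≗g fzero) (Σℤ-cong (f≗g ∘ fsuc))

Σℤ-zero : ∀ n → Σℤ {n} (λ _ → 0ℤ) ≡ 0ℤ
Σℤ-zero n = trans (Σℤ≡sum {n} (λ _ → 0ℤ)) (sum-replicate-zero n)

Σℤ-distrib-+ : (f g : Fin n → ℤ) → Σℤ (λ k → f k + g k) ≡ Σℤ f + Σℤ g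
Σℤ-distrib-+ f g = trans (Σℤ≡sum (λ k → f k + g k))
  (trans (∑-distrib-+ f g) (sym (cong₂ _+_ (Σℤ≡sum f) (Σℤ≡sum g))))

*-distribˡ-Σℤ : (x : ℤ) (f : Fin n → ℤ) → x * Σℤ f ≡ Σℤ (λ k → x * f k)
*-distribˡ-Σℤ x f = trans (cong (x *_) (Σℤ≡sum f))
  (trans (*-distribˡ-sum x f) (sym (Σℤ≡sum (λ k → x * f k))))

Σℤ-comm : (f : Fin m → Fin n → ℤ) →
  Σℤ (λ k → Σℤ (λ l → f k l)) ≡ Σℤ (λ l → Σℤ (λ k → f k l))
Σℤ-comm f = trans (Σℤ²≡sum² f) (trans (∑-comm f) (sym (Σℤ²≡sum² (λ l k → f k l))))
  where
  Σℤ²≡sum² : ∀ {m n} (g : Fin m → Fin n → ℤ) →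
    Σℤ (λ k → Σℤ (g k)) ≡ sum (λ k → sum (g k))
  Σℤ²≡sum² g = trans (Σℤ-cong (λ k → Σℤ≡sum (g k))) (Σℤ≡sum (λ k → sum (g k)))

neg-distrib-Σℤ : (f : Fin n → ℤ) → - Σℤ f ≡ Σℤ (λ k → - f k)
neg-distrib-Σℤ {zero}  f = refl
neg-distrib-Σℤ {suc n} f =
  trans (neg-distrib-+ (f fzero) _) (cong (_+_ (- f fzero)) (neg-distrib-Σℤ (f ∘ fsuc)))

Σℤ-mono-≤ : {f g : Fin n → ℤ} → (∀ k → f k ≤ g k) → Σℤ f ≤ Σℤ g
Σℤ-mono-≤ {zero}  f≤g = ≤-refl
Σℤ-mono-≤ {suc n} f≤g = +-mono-≤ (f≤g fzero) (Σℤ-mono-≤ (f≤g ∘ fsuc))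

Σℤ-mono-< : {f g : Fin n → ℤ} → (∀ k → f k ≤ g k) → ∀ t → f t < g t → Σℤ f < Σℤ g
Σℤ-mono-< f≤g fzero    ft<gt = +-mono-<-≤ ft<gt (Σℤ-mono-≤ (f≤g ∘ fsuc))
Σℤ-mono-< f≤g (fsuc t) ft<gt = +-mono-≤-< (f≤g fzero) (Σℤ-mono-< (f≤g ∘ fsuc) t ft<gt)

Σℤ-nonneg : {f : Fin n → ℤ} → (∀ k → 0ℤ ≤ f k) → 0ℤ ≤ Σℤ f
Σℤ-nonneg {n} {f} 0≤f = subst (_≤ Σℤ f) (Σℤ-zero n) (Σℤ-mono-≤ 0≤f)

Σℤ-pos : {f : Fin n → ℤ} → (∀ k → 0ℤ ≤ f k) → ∀ t → 0ℤ < f t → 0ℤ < Σℤ f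
Σℤ-pos {n} {f} 0≤f t 0<ft = subst (_< Σℤ f) (Σℤ-zero n) (Σℤ-mono-< 0≤f t 0<ft)

Σℤ-nonpos : {f : Fin n → ℤ} → (∀ k → f k ≤ 0ℤ) → Σℤ f ≤ 0ℤ
Σℤ-nonpos {n} {f} f≤0 = subst (Σℤ f ≤_) (Σℤ-zero n) (Σℤ-mono-≤ f≤0)

Σℤ-neg : {f : Fin n → ℤ} → (∀ k → f k ≤ 0ℤ) → ∀ t → f t < 0ℤ → Σℤ f < 0ℤ
Σℤ-neg {n} {f} f≤0 t ft<0 = subst (Σℤ f <_) (Σℤ-zero n) (Σℤ-mono-< f≤0 t ft<0)

positive-term : (f : Fin n → ℤ) → 0ℤ < Σℤ f → ∃ λ k → 0ℤ < f k
positive-term f 0<Σf with any? (λ k → 0ℤ <? f k)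
... | yes ∃pos = ∃pos
... | no  ∄pos = ⊥-elim (<⇒≱ 0<Σf (Σℤ-nonpos (λ k → ≮⇒≥ (∄pos ∘ (k ,_)))))

positive-term-of-zero-sum : (f : Fin n → ℤ) → Σℤ f ≡ 0ℤ →
  ∀ t → f t < 0ℤ → ∃ λ k → 0ℤ < f k
positive-term-of-zero-sum f Σf≡0 t ft<0 with any? (λ k → 0ℤ <? f k)
... | yes ∃pos = ∃pos
... | no  ∄pos = ⊥-elim (<⇒≢ (Σℤ-neg (λ k → ≮⇒≥ (∄pos ∘ (k ,_))) t ft<0) Σf≡0)

negative-term-of-zero-sum : (f : Fin n → ℤ) → Σℤ f ≡ 0ℤ →
  ∀ t → 0ℤ < f t → ∃ λ k → f k < 0ℤ
negative-term-of-zero-sum f Σf≡0 t 0<ft with any? (λ k → f k <? 0ℤ)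
... | yes ∃neg = ∃neg
... | no  ∄neg = ⊥-elim (<⇒≢ (Σℤ-pos (λ k → ≮⇒≥ (∄neg ∘ (k ,_))) t 0<ft) (sym Σf≡0))

-- Indicators and basic moves

𝟙 : Bool → ℤ
𝟙 s = if s then 1ℤ else 0ℤ

if-then-0≡𝟙* : (s : Bool) (x : ℤ) → (if s then x else 0ℤ) ≡ 𝟙 s * x
if-then-0≡𝟙* true  x = sym (*-identityˡ x)
if-then-0≡𝟙* false x = refl

if-∧-then-0≡𝟙*𝟙* : (s t : Bool) (x : ℤ) → (if s ∧ t then x else 0ℤ) ≡ 𝟙 s * (𝟙 t * x)
if-∧-then-0≡𝟙*𝟙* true  t x = trans (if-then-0≡𝟙* t x) (sym (*-identityˡ _))
if-∧-then-0≡𝟙*𝟙* false t x = refl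

𝟙*-pos : ∀ s x → 0ℤ < 𝟙 s * x → s ≡ true × 0ℤ < x
𝟙*-pos true  x 0<x = refl , subst (0ℤ <_) (*-identityˡ x) 0<x
𝟙*-pos false x 0<0 = ⊥-elim (<-irrefl refl 0<0)

𝟙*-neg : ∀ s x → 𝟙 s * x < 0ℤ → s ≡ true × x < 0ℤ
𝟙*-neg true  x x<0 = refl , subst (_< 0ℤ) (*-identityˡ x) x<0
𝟙*-neg false x 0<0 = ⊥-elim (<-irrefl refl 0<0)

-- With does rather than ⌊_⌋, δ (suc k) (suc i) reduces to δ k i.
δ : Fin n → Fin n → ℤ
δ k i = 𝟙 (does (k ≟ i))

Σℤ-δ : (v : Fin n → ℤ) (i : Fin n) → Σℤ (λ k → δ k i * v k) ≡ v i
Σℤ-δ {suc n} v fzero = begin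
  1ℤ * v fzero + Σℤ {n} (λ _ → 0ℤ) ≡⟨ cong₂ _+_ (*-identityˡ (v fzero)) (Σℤ-zero n) ⟩
  v fzero + 0ℤ                     ≡⟨ +-identityʳ _ ⟩
  v fzero                          ∎
  where open ≡-Reasoning
Σℤ-δ {suc n} v (fsuc i) =
  trans (+-identityˡ (Σℤ (λ k → δ k i * v (fsuc k)))) (Σℤ-δ (v ∘ fsuc) i)

Δ : Fin n → Fin n → Fin n → ℤ
Δ i i′ k = δ k i - δ k i′

Σℤ-Δ : (i i′ : Fin n) (v : Fin n → ℤ) → Σℤ (λ k → Δ i i′ k * v k) ≡ v i - v i′
Σℤ-Δ {n} i i′ v = begin
  Σℤ (λ k → Δ i i′ k * v k)
    ≡⟨ Σℤ-cong (λ k → split (δ k i) (δ k i′) (v k)) ⟩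
  Σℤ (λ k → δ k i * v k + - (δ k i′ * v k))
    ≡⟨ Σℤ-distrib-+ (δ· i) (λ k → - δ· i′ k) ⟩
  Σℤ (δ· i) + Σℤ (λ k → - δ· i′ k)
    ≡⟨ cong (_+_ (Σℤ (δ· i))) (sym (neg-distrib-Σℤ (δ· i′))) ⟩
  Σℤ (δ· i) - Σℤ (δ· i′)
    ≡⟨ cong₂ _-_ (Σℤ-δ v i) (Σℤ-δ v i′) ⟩
  v i - v i′ ∎
  where
  open ≡-Reasoning
  δ· : Fin n → Fin n → ℤ
  δ· i k = δ k i * v k
  split : ∀ a b x → (a - b) * x ≡ a * x + - (b * x)
  split = solve-∀

Σℤ-Δ-zero : (i i′ : Fin n) → Σℤ (Δ i i′) ≡ 0ℤ
Σℤ-Δ-zero i i′ =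
  trans (Σℤ-cong (λ k → sym (*-identityʳ (Δ i i′ k))))
        (trans (Σℤ-Δ i i′ (λ _ → 1ℤ)) (+-inverseʳ 1ℤ))

basicMove≡Δ⊗Δ : (i i′ : Fin R) (j j′ : Fin C) → ∀ k l →
  basicMove i i′ j j′ k l ≡ Δ i i′ k * Δ j j′ l
basicMove≡Δ⊗Δ i i′ j j′ k l = begin
  basicMove i i′ j j′ k l
    ≡⟨ cong₂ _+_ (cong₂ _+_ (cong₂ _+_ (entry i j 1ℤ) (entry i′ j′ 1ℤ)) (entry i j′ -1ℤ))
                 (entry i′ j -1ℤ) ⟩
  δ k i * (δ l j * 1ℤ) + δ k i′ * (δ l j′ * 1ℤ) + δ k i * (δ l j′ * -1ℤ) + δ k i′ * (δ l j * -1ℤ)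
    ≡⟨ expand (δ k i) (δ k i′) (δ l j) (δ l j′) ⟩
  Δ i i′ k * Δ j j′ l ∎
  where
  open ≡-Reasoning
  entry : ∀ a b x → (if ⌊ k ≟ a ⌋ ∧ ⌊ l ≟ b ⌋ then x else 0ℤ) ≡ δ k a * (δ l b * x)
  entry a b x = trans (if-∧-then-0≡𝟙*𝟙* ⌊ k ≟ a ⌋ ⌊ l ≟ b ⌋ x)
    (cong₂ (λ s t → 𝟙 s * (𝟙 t * x)) (isYes≗does (k ≟ a)) (isYes≗does (l ≟ b)))
  expand : ∀ a a′ b b′ →
    a * (b * 1ℤ) + a′ * (b′ * 1ℤ) + a * (b′ * -1ℤ) + a′ * (b * -1ℤ) ≡ (a - a′) * (b - b′)
  expand = solve-∀

basicMove-transpose : (i i′ : Fin R) (j j′ : Fin C) → ∀ k l →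
  basicMove i i′ j j′ k l ≡ basicMove j j′ i i′ l k
basicMove-transpose i i′ j j′ k l = begin
  basicMove i i′ j j′ k l ≡⟨ basicMove≡Δ⊗Δ i i′ j j′ k l ⟩
  Δ i i′ k * Δ j j′ l     ≡⟨ *-comm (Δ i i′ k) (Δ j j′ l) ⟩
  Δ j j′ l * Δ i i′ k     ≡⟨ sym (basicMove≡Δ⊗Δ j j′ i i′ l k) ⟩
  basicMove j j′ i i′ l k ∎
  where open ≡-Reasoning

neg-basicMove : (i i′ : Fin R) (j j′ : Fin C) → ∀ k l →
  - basicMove i i′ j j′ k l ≡ basicMove i i′ j′ j k l
neg-basicMove i i′ j j′ k l = begin
  - basicMove i i′ j j′ k l                ≡⟨ cong -_ (basicMove≡Δ⊗Δ i i′ j j′ k l) ⟩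
  - ((δ k i - δ k i′) * (δ l j - δ l j′))  ≡⟨ flip (δ k i) (δ k i′) (δ l j) (δ l j′) ⟩
  (δ k i - δ k i′) * (δ l j′ - δ l j)      ≡⟨ sym (basicMove≡Δ⊗Δ i i′ j′ j k l) ⟩
  basicMove i i′ j′ j k l                  ∎
  where
  open ≡-Reasoning
  flip : ∀ a a′ b b′ → - ((a - a′) * (b - b′)) ≡ (a - a′) * (b′ - b)
  flip = solve-∀

Σℤ-basicMove-row : (i i′ : Fin R) (j j′ : Fin C) (w : Fin C → ℤ) → ∀ k →
  Σℤ (λ l → w l * basicMove i i′ j j′ k l) ≡ Δ i i′ k * (w j - w j′)
Σℤ-basicMove-row i i′ j j′ w k = begin
  Σℤ (λ l → w l * basicMove i i′ j j′ k l)
    ≡⟨ Σℤ-cong (λ l → cong (w l *_) (basicMove≡Δ⊗Δ i i′ j j′ k l)) ⟩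
  Σℤ (λ l → w l * (Δ i i′ k * Δ j j′ l))
    ≡⟨ Σℤ-cong (λ l → reorder (w l) (Δ i i′ k) (Δ j j′ l)) ⟩
  Σℤ (λ l → Δ i i′ k * (Δ j j′ l * w l))
    ≡⟨ sym (*-distribˡ-Σℤ (Δ i i′ k) (λ l → Δ j j′ l * w l)) ⟩
  Δ i i′ k * Σℤ (λ l → Δ j j′ l * w l)
    ≡⟨ cong (Δ i i′ k *_) (Σℤ-Δ j j′ w) ⟩
  Δ i i′ k * (w j - w j′) ∎
  where
  open ≡-Reasoning
  reorder : ∀ x a b → x * (a * b) ≡ a * (b * x)
  reorder = solve-∀

Σℤ-basicMove-col : (i i′ : Fin R) (j j′ : Fin C) (w : Fin R → ℤ) → ∀ l →
  Σℤ (λ k → w k * basicMove i i′ j j′ k l) ≡ Δ j j′ l * (w i - w i′)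
Σℤ-basicMove-col i i′ j j′ w l =
  trans (Σℤ-cong (λ k → cong (w k *_) (basicMove-transpose i i′ j j′ k l)))
        (Σℤ-basicMove-row j j′ i i′ w l)

Σℤ²-basicMove : (i i′ : Fin R) (j j′ : Fin C) (w : Fin R → Fin C → ℤ) →
  Σℤ (λ k → Σℤ (λ l → w k l * basicMove i i′ j j′ k l)) ≡ (w i j - w i j′) - (w i′ j - w i′ j′)
Σℤ²-basicMove i i′ j j′ w =
  trans (Σℤ-cong (λ k → Σℤ-basicMove-row i i′ j j′ (w k) k)) (Σℤ-Δ i i′ (λ k → w k j - w k j′))

rowSum-basicMove : (i i′ : Fin R) (j j′ : Fin C) → ∀ k → rowSum (basicMove i i′ j j′) k ≡ 0ℤ
rowSum-basicMove i i′ j j′ k =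
  trans (Σℤ-cong (λ l → sym (*-identityˡ (basicMove i i′ j j′ k l))))
        (trans (Σℤ-basicMove-row i i′ j j′ (λ _ → 1ℤ) k) (*-zeroʳ (Δ i i′ k)))

colSum-basicMove : (i i′ : Fin R) (j j′ : Fin C) → ∀ l → colSum (basicMove i i′ j j′) l ≡ 0ℤ
colSum-basicMove i i′ j j′ l =
  trans (Σℤ-cong (λ k → sym (*-identityˡ (basicMove i i′ j j′ k l))))
        (trans (Σℤ-basicMove-col i i′ j j′ (λ _ → 1ℤ) l) (*-zeroʳ (Δ j j′ l)))

Δ-at-source : {i i′ : Fin n} → i ≢ i′ → Δ i i′ i ≡ 1ℤ
Δ-at-source {i = i} {i′} i≢i′ with i ≟ i | i ≟ i′
... | yes _   | no _     = refl
... | yes _   | yes i≡i′ = ⊥-elim (i≢i′ i≡i′)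
... | no i≢i  | _        = ⊥-elim (i≢i refl)

basicMove-at-source : (i i′ : Fin R) (j j′ : Fin C) → i ≢ i′ → j ≢ j′ → basicMove i i′ j j′ i j ≡ 1ℤ
basicMove-at-source i i′ j j′ i≢i′ j≢j′ =
  trans (basicMove≡Δ⊗Δ i i′ j j′ i j) (cong₂ _*_ (Δ-at-source i≢i′) (Δ-at-source j≢j′))

-- Norms under moves that only lower positive entries

LowersOnlyPositive : ℤ → ℤ → Set
LowersOnlyPositive x m = 0ℤ ≤ m ⊎ (m ≡ -1ℤ × 0ℤ < x)

LowersOnlyPositive-nonneg : ∀ {x m} → 0ℤ ≤ x → LowersOnlyPositive x m → 0ℤ ≤ x + m
LowersOnlyPositive-nonneg          0≤x (inj₁ 0≤m)          = +-mono-≤ 0≤x 0≤m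
LowersOnlyPositive-nonneg {+[1+ n ]} _ (inj₂ (refl , _))     = +≤+ z≤n
LowersOnlyPositive-nonneg {+0}       _ (inj₂ (refl , +<+ ()))

LowersOnlyPositive-mono : ∀ {x y m} → x ≤ y → LowersOnlyPositive x m → LowersOnlyPositive y m
LowersOnlyPositive-mono x≤y (inj₁ 0≤m)        = inj₁ 0≤m
LowersOnlyPositive-mono x≤y (inj₂ (m≡-1 , 0<x)) = inj₂ (m≡-1 , <-≤-trans 0<x x≤y)

∣+∣-≤ : ∀ {x m} → LowersOnlyPositive x m → + ∣ x + m ∣ ≤ + ∣ x ∣ + m
∣+∣-≤ {x}         (inj₁ (+≤+ {n = k} _))  = +≤+ (∣i+j∣≤∣i∣+∣j∣ x (+ k))
∣+∣-≤ {+[1+ n ]}  (inj₂ (refl , _))       = ≤-refl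
∣+∣-≤ {+0}        (inj₂ (refl , +<+ ()))
∣+∣-≤ { -[1+ n ]} (inj₂ (refl , ()))

∣+1∣-< : ∀ {x} → x < 0ℤ → + ∣ x + 1ℤ ∣ < + ∣ x ∣ + 1ℤ
∣+1∣-< { -[1+ zero ]}  _ = +<+ (s≤s z≤n)
∣+1∣-< { -[1+ suc n ]} _ = +<+ (ℕₚ.<-≤-trans (ℕₚ.n<1+n (suc n)) (ℕₚ.m≤m+n (suc (suc n)) 1))
∣+1∣-< {+ n} (+<+ ())

0≤i<j⇒∣i∣<∣j∣ : ∀ {i j} → 0ℤ ≤ i → i < j → ∣ i ∣ ℕ.< ∣ j ∣
0≤i<j⇒∣i∣<∣j∣ (+≤+ _) (+<+ m<n) = m<n

∥_∥₁ : (Fin n → ℤ) → ℤ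
∥ v ∥₁ = Σℤ (λ k → + ∣ v k ∣)

∥∥₁-nonneg : (v : Fin n → ℤ) → 0ℤ ≤ ∥ v ∥₁
∥∥₁-nonneg v = Σℤ-nonneg {f = λ k → + ∣ v k ∣} (λ _ → +≤+ z≤n)

∥∥₁-cong : {v w : Fin n → ℤ} → (∀ k → v k ≡ w k) → ∥ v ∥₁ ≡ ∥ w ∥₁
∥∥₁-cong v≗w = Σℤ-cong (λ k → cong (+_ ∘ ∣_∣) (v≗w k))

∥∥₁-+-balanced : (v w : Fin n → ℤ) → Σℤ w ≡ 0ℤ → Σℤ (λ k → + ∣ v k ∣ + w k) ≡ ∥ v ∥₁
∥∥₁-+-balanced v w Σw≡0 = begin
  Σℤ (λ k → + ∣ v k ∣ + w k)  ≡⟨ Σℤ-distrib-+ (λ k → + ∣ v k ∣) w ⟩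
  ∥ v ∥₁ + Σℤ w               ≡⟨ cong (_+_ ∥ v ∥₁) Σw≡0 ⟩
  ∥ v ∥₁ + 0ℤ                 ≡⟨ +-identityʳ _ ⟩
  ∥ v ∥₁                      ∎
  where open ≡-Reasoning

∥+∥₁-≤ : (v w : Fin n → ℤ) → (∀ k → LowersOnlyPositive (v k) (w k)) → Σℤ w ≡ 0ℤ →
  ∥ (λ k → v k + w k) ∥₁ ≤ ∥ v ∥₁
∥+∥₁-≤ v w lowers Σw≡0 =
  ≤-trans (Σℤ-mono-≤ (λ k → ∣+∣-≤ (lowers k))) (≤-reflexive (∥∥₁-+-balanced v w Σw≡0))

∥+∥₁-< : (v w : Fin n → ℤ) → (∀ k → LowersOnlyPositive (v k) (w k)) → Σℤ w ≡ 0ℤ →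
  ∀ t → v t < 0ℤ → w t ≡ 1ℤ → ∥ (λ k → v k + w k) ∥₁ < ∥ v ∥₁
∥+∥₁-< v w lowers Σw≡0 t vt<0 wt≡1 =
  <-≤-trans (Σℤ-mono-< (λ k → ∣+∣-≤ (lowers k)) t at-t) (≤-reflexive (∥∥₁-+-balanced v w Σw≡0))
  where
  at-t : + ∣ v t + w t ∣ < + ∣ v t ∣ + w t
  at-t rewrite wt≡1 = ∣+1∣-< vt<0

Δ-lowersOnlyPositive : {i i′ : Fin n} (v : Fin n → ℤ) → i ≢ i′ → 0ℤ < v i →
  ∀ k → LowersOnlyPositive (v k) (Δ i′ i k)
Δ-lowersOnlyPositive {i = i} {i′} v i≢i′ 0<vi k with k ≟ i′ | k ≟ i
... | yes refl | yes refl = ⊥-elim (i≢i′ refl)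
... | yes refl | no _     = inj₁ (+≤+ z≤n)
... | no _     | yes refl = inj₂ (refl , 0<vi)
... | no _     | no _     = inj₁ (+≤+ z≤n)

basicMove-lowersOnlyPositive : (E : Array R C) (i i′ : Fin R) (j j′ : Fin C) → i ≢ i′ → j ≢ j′ →
  0ℤ < E i j′ → 0ℤ < E i′ j → ∀ k l → LowersOnlyPositive (E k l) (basicMove i i′ j j′ k l)
basicMove-lowersOnlyPositive E i i′ j j′ i≢i′ j≢j′ 0<Eij′ 0<Ei′j k l
  with k ≟ i | k ≟ i′ | l ≟ j | l ≟ j′
... | yes refl | yes refl | _        | _        = ⊥-elim (i≢i′ refl)
... | _        | _        | yes refl | yes refl = ⊥-elim (j≢j′ refl)
... | yes refl | no _     | no _     | yes refl = inj₂ (refl , 0<Eij′)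
... | no _     | yes refl | yes refl | no _     = inj₂ (refl , 0<Ei′j)
... | yes refl | no _     | yes refl | no _     = inj₁ (+≤+ z≤n)
... | yes refl | no _     | no _     | no _     = inj₁ (+≤+ z≤n)
... | no _     | yes refl | no _     | yes refl = inj₁ (+≤+ z≤n)
... | no _     | yes refl | no _     | no _     = inj₁ (+≤+ z≤n)
... | no _     | no _     | yes refl | no _     = inj₁ (+≤+ z≤n)
... | no _     | no _     | no _     | yes refl = inj₁ (+≤+ z≤n)
... | no _     | no _     | no _     | no _     = inj₁ (+≤+ z≤n)

-- Fibers and connectivity

if-then-0-+ : ∀ s x y → (if s then x + y else 0ℤ) ≡ (if s then x else 0ℤ) + (if s then y else 0ℤ)
if-then-0-+ true  x y = refl
if-then-0-+ false x y = refl

if-then-0-neg : ∀ s x → (if s then - x else 0ℤ) ≡ - (if s then x else 0ℤ)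
if-then-0-neg true  x = refl
if-then-0-neg false x = refl

module _ (A B : Array R C) where

  rowSum-⊕ : ∀ k → rowSum (A ⊕ B) k ≡ rowSum A k + rowSum B k
  rowSum-⊕ k = Σℤ-distrib-+ (A k) (B k)

  colSum-⊕ : ∀ l → colSum (A ⊕ B) l ≡ colSum A l + colSum B l
  colSum-⊕ l = Σℤ-distrib-+ (λ k → A k l) (λ k → B k l)

  sumOver-⊕ : (S : Subset R C) → sumOver S (A ⊕ B) ≡ sumOver S A + sumOver S B
  sumOver-⊕ S = trans (Σℤ-cong row) (Σℤ-distrib-+ (λ k → Σℤ (λ l → if S k l then A k l else 0ℤ)) _)
    where
    row : ∀ k → Σℤ (λ l → if S k l then A k l + B k l else 0ℤ)
              ≡ Σℤ (λ l → if S k l then A k l else 0ℤ) + Σℤ (λ l → if S k l then B k l else 0ℤ)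
    row k = trans (Σℤ-cong (λ l → if-then-0-+ (S k l) (A k l) (B k l)))
                  (Σℤ-distrib-+ (λ l → if S k l then A k l else 0ℤ) _)

module _ (A : Array R C) where

  rowSum-neg : ∀ k → rowSum (negA A) k ≡ - rowSum A k
  rowSum-neg k = sym (neg-distrib-Σℤ (A k))

  colSum-neg : ∀ l → colSum (negA A) l ≡ - colSum A l
  colSum-neg l = sym (neg-distrib-Σℤ (λ k → A k l))

  sumOver-neg : (S : Subset R C) → sumOver S (negA A) ≡ - sumOver S A
  sumOver-neg S =
    trans (Σℤ-cong row) (sym (neg-distrib-Σℤ (λ k → Σℤ (λ l → if S k l then A k l else 0ℤ))))
    where
    row : ∀ k → Σℤ (λ l → if S k l then - A k l else 0ℤ) ≡ - Σℤ (λ l → if S k l then A k l else 0ℤ)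
    row k = trans (Σℤ-cong (λ l → if-then-0-neg (S k l) (A k l)))
                  (sym (neg-distrib-Σℤ (λ l → if S k l then A k l else 0ℤ)))


sumOver-cong : (S : Subset R C) {A B : Array R C} → A ≋ B → sumOver S A ≡ sumOver S B
sumOver-cong S A≋B = Σℤ-cong (λ k → Σℤ-cong (λ l → cong (if S k l then_else 0ℤ) (A≋B k l)))

IsMove-neg : (S : Subset R C) {M : Array R C} → IsMove S M → IsMove S (negA M)
IsMove-neg S {M} (rows , cols , diag) =
  (λ k → trans (rowSum-neg M k) (cong -_ (rows k))) ,
  (λ l → trans (colSum-neg M l) (cong -_ (cols l))) ,
  trans (sumOver-neg M S) (cong -_ diag)

difference : Table R C → Table R C → Array R C
difference X Y = toArray X ⊕ negA (toArray Y)

transpose : Array R C → Array C R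
transpose E l k = E k l

module _ (S : Subset R C) where

  SameFiber-refl : ∀ {X} → SameFiber S X X
  SameFiber-refl = (λ _ → refl) , (λ _ → refl) , refl

  SameFiber-sym : ∀ {X Y} → SameFiber S X Y → SameFiber S Y X
  SameFiber-sym (rows , cols , diag) = (sym ∘ rows) , (sym ∘ cols) , sym diag

  SameFiber-trans : ∀ {X Y Z} → SameFiber S X Y → SameFiber S Y Z → SameFiber S X Z
  SameFiber-trans (rows , cols , diag) (rows′ , cols′ , diag′) =
    (λ k → trans (rows k) (rows′ k)) , (λ l → trans (cols l) (cols′ l)) , trans diag diag′

  SameFiber⇒IsMove-difference : ∀ {X Y} → SameFiber S X Y → IsMove S (difference X Y)
  SameFiber⇒IsMove-difference {X} {Y} (rows , cols , diag) =
    (λ k → trans (rowSum-⊕ X′ (negA Y′) k) (cancel (rows k) (rowSum-neg Y′ k))) ,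
    (λ l → trans (colSum-⊕ X′ (negA Y′) l) (cancel (cols l) (colSum-neg Y′ l))) ,
    trans (sumOver-⊕ X′ (negA Y′) S) (cancel diag (sumOver-neg Y′ S))
    where
    X′ = toArray X
    Y′ = toArray Y
    cancel : ∀ {x y z} → x ≡ y → z ≡ - y → x + z ≡ 0ℤ
    cancel {y = y} refl refl = +-inverseʳ y

  SameFiber-⊕ : ∀ {X Z M} → IsMove S M → toArray Z ≋ (toArray X ⊕ M) → SameFiber S X Z
  SameFiber-⊕ {X} {Z} {M} (rows , cols , diag) Z≋X⊕M =
    (λ k → sym (trans (Σℤ-cong (Z≋X⊕M k)) (trans (rowSum-⊕ X′ M k) (adds-zero (rows k))))) ,
    (λ l → sym (trans (Σℤ-cong (λ k → Z≋X⊕M k l)) (trans (colSum-⊕ X′ M l) (adds-zero (cols l))))) ,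
    sym (trans (sumOver-cong S Z≋X⊕M) (trans (sumOver-⊕ X′ M S) (adds-zero diag)))
    where
    X′ = toArray X
    adds-zero : ∀ {x y} → y ≡ 0ℤ → x + y ≡ x
    adds-zero refl = +-identityʳ _

module _ (S : Subset R C) (𝓑 : ArraySet R C) where

  connects-refl : ∀ {X Y} → toArray Y ≋ toArray X → Connects S 𝓑 X Y
  connects-refl {X} Y≋X = [] , [] , within , (λ k l → trans (Y≋X k l) (sym (+-identityʳ _)))
    where
    within : ∀ a → a ℕ.≤ 0 →
      Σ (Table R C) λ W → (toArray W ≋ (toArray X ⊕ sumMoves (take a []))) × SameFiber S X W
    within zero z≤n = X , (λ k l → sym (+-identityʳ _)) , SameFiber-refl S

  connects-step : ∀ {X Z Y M} → 𝓑 M → IsMove S M → toArray Z ≋ (toArray X ⊕ M) →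
    Connects S 𝓑 Z Y → Connects S 𝓑 X Y
  connects-step {X} {Z} {Y} {M} 𝓑M isMove Z≋X⊕M (Ms , 𝓑Ms , within , Y≋Z⊕ΣMs) =
    M ∷ Ms , 𝓑M ∷ 𝓑Ms , within′ , (λ k l → trans (Y≋Z⊕ΣMs k l) (shift k l _))
    where
    shift : ∀ k l u → toArray Z k l + u ≡ toArray X k l + (M k l + u)
    shift k l u = trans (cong (_+ u) (Z≋X⊕M k l)) (+-assoc (toArray X k l) (M k l) u)
    within′ : ∀ a → a ℕ.≤ length (M ∷ Ms) →
      Σ (Table R C) λ W → (toArray W ≋ (toArray X ⊕ sumMoves (take a (M ∷ Ms)))) × SameFiber S X W
    within′ zero    _          = X , (λ k l → sym (+-identityʳ _)) , SameFiber-refl S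
    within′ (suc a) (s≤s a≤n) with within a a≤n
    ... | W , W≋Z⊕ΣMs , Z~W = W , (λ k l → trans (W≋Z⊕ΣMs k l) (shift k l _)) ,
                               SameFiber-trans S (SameFiber-⊕ S isMove Z≋X⊕M) Z~W

  connects-by-descent : (Y : Table R C) (φ : Table R C → ℕ) →
    (∀ X → SameFiber S X Y → ∀ k l → X k l ≢ Y k l →
       Σ (Array R C) λ M → Σ (Table R C) λ Z →
         𝓑 M × IsMove S M × toArray Z ≋ (toArray X ⊕ M) × φ Z ℕ.< φ X) →
    ∀ X → SameFiber S X Y → Connects S 𝓑 X Y
  connects-by-descent Y φ descend X X~Y = go (suc (φ X)) X X~Y ℕₚ.≤-refl
    where
    go : ∀ n X → SameFiber S X Y → φ X ℕ.< n → Connects S 𝓑 X Y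
    go (suc n) X X~Y φX<1+n with all? (λ k → all? (λ l → X k l ℕ.≟ Y k l))
    ... | yes X≗Y = connects-refl (λ k l → cong +_ (sym (X≗Y k l)))
    ... | no  X≢Y with ¬∀⟶∃¬ _ _ (λ k → all? (λ l → X k l ℕ.≟ Y k l)) X≢Y
    ...   | k , Xk≢Yk with ¬∀⟶∃¬ _ _ (λ l → X k l ℕ.≟ Y k l) Xk≢Yk
    ...     | l , Xkl≢Ykl with descend X X~Y k l Xkl≢Ykl
    ...       | M , Z , 𝓑M , isMove , Z≋X⊕M , φZ<φX =
      connects-step 𝓑M isMove Z≋X⊕M
        (go n Z (SameFiber-trans S (SameFiber-sym S (SameFiber-⊕ S isMove Z≋X⊕M)) X~Y)
            (ℕₚ.<-≤-trans φZ<φX (s≤s⁻¹ φX<1+n)))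

B₀-neg : (S : Subset R C) → ∀ B → B₀ S B → B₀ S (negA B)
B₀-neg S B ((i , i′ , j , j′ , i≢i′ , j≢j′ , B≋) , isMove) =
  (i , i′ , j′ , j , i≢i′ , j≢j′ ∘ sym ,
   λ k l → trans (cong -_ (B≋ k l)) (neg-basicMove i i′ j j′ k l)) ,
  IsMove-neg S isMove

B₀-finite : (S : Subset R C) → FiniteSet (B₀ S)
B₀-finite {R} {C} S = map basicMove′ indices , listed
  where
  basicMove′ : Fin R × Fin R × Fin C × Fin C → Array R C
  basicMove′ (i , i′ , j , j′) = basicMove i i′ j j′
  indices = cartesianProduct (allFin R)
              (cartesianProduct (allFin R) (cartesianProduct (allFin C) (allFin C)))
  listed : ∀ B → B₀ S B → Any.Any (B ≋_) (map basicMove′ indices)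
  listed B ((i , i′ , j , j′ , _ , _ , B≋) , _) =
    Any.map (λ eq → subst (B ≋_) eq B≋)
      (∈-map⁺ basicMove′ (∈-cartesianProduct⁺ (∈-allFin i)
        (∈-cartesianProduct⁺ (∈-allFin i′) (∈-cartesianProduct⁺ (∈-allFin j) (∈-allFin j′)))))

-- Block structure

_≡ᵇ_ : Bool → Bool → Bool
true  ≡ᵇ t = t
false ≡ᵇ t = not t

≡ᵇ-refl : ∀ s → s ≡ᵇ s ≡ true
≡ᵇ-refl true  = refl
≡ᵇ-refl false = refl

≡ᵇ⇒≡ : ∀ s t → s ≡ᵇ t ≡ true → s ≡ t
≡ᵇ⇒≡ true  true  _ = refl
≡ᵇ⇒≡ false false _ = refl

record BlockLabelling (S : Subset R C) : Set where
  field
    rowSide : Fin R → Bool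
    colSide : Fin C → Bool
    S≡sameSide : ∀ k l → S k l ≡ rowSide k ≡ᵇ colSide l

diagonal⇔⇒≡ᵇ : ∀ s {m n r c : ℕ} →
  (s ≡ true ⇔ ((m ℕ.< r × n ℕ.< c) ⊎ (m ℕ.≥ r × n ℕ.≥ c))) → s ≡ ⌊ m ℕ.<? r ⌋ ≡ᵇ ⌊ n ℕ.<? c ⌋
diagonal⇔⇒≡ᵇ s {m} {n} {r} {c} s⇔ with m ℕ.<? r | n ℕ.<? c
... | yes m<r | yes n<c = Equivalence.from s⇔ (inj₁ (m<r , n<c))
... | no  m≮r | no  n≮c = Equivalence.from s⇔ (inj₂ (ℕₚ.≮⇒≥ m≮r , ℕₚ.≮⇒≥ n≮c))
... | yes m<r | no  n≮c =
  ¬-not (λ s≡true → [ n≮c ∘ proj₂ , ℕₚ.<⇒≱ m<r ∘ proj₁ ]′ (Equivalence.to s⇔ s≡true))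
... | no  m≮r | yes n<c =
  ¬-not (λ s≡true → [ m≮r ∘ proj₁ , ℕₚ.<⇒≱ n<c ∘ proj₂ ]′ (Equivalence.to s⇔ s≡true))

block2x2⇒labelling : {S : Subset R C} → Block2x2 S → BlockLabelling S
block2x2⇒labelling {R} {C} {S} (r , c , _ , _ , σ , τ , S⇔) = record
  { rowSide    = λ k → ⌊ toℕ (σ ⟨$⟩ˡ k) ℕ.<? r ⌋
  ; colSide    = λ l → ⌊ toℕ (τ ⟨$⟩ˡ l) ℕ.<? c ⌋
  ; S≡sameSide = λ k l → diagonal⇔⇒≡ᵇ (S k l) (S⇔′ k l)
  }
  where
  diagonal : Fin R → Fin C → Set
  diagonal k l = (toℕ (σ ⟨$⟩ˡ k) ℕ.< r × toℕ (τ ⟨$⟩ˡ l) ℕ.< c) ⊎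
                 (toℕ (σ ⟨$⟩ˡ k) ℕ.≥ r × toℕ (τ ⟨$⟩ˡ l) ℕ.≥ c)
  S⇔′ : ∀ k l → S k l ≡ true ⇔ diagonal k l
  S⇔′ k l = subst₂ (λ k′ l′ → S k′ l′ ≡ true ⇔ diagonal k l) (inverseʳ σ) (inverseʳ τ)
                   (S⇔ (σ ⟨$⟩ˡ k) (τ ⟨$⟩ˡ l))

module _ {S : Subset R C} (L : BlockLabelling S) where
  open BlockLabelling L

  basicMove-isMove : (i i′ : Fin R) (j j′ : Fin C) →
    rowSide i ≡ rowSide i′ ⊎ colSide j ≡ colSide j′ → IsMove S (basicMove i i′ j j′)
  basicMove-isMove i i′ j j′ sameSide =
    rowSum-basicMove i i′ j j′ , colSum-basicMove i i′ j j′ ,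
    trans (Σℤ-cong (λ k → Σℤ-cong (λ l → if-then-0≡𝟙* (S k l) (basicMove i i′ j j′ k l))))
          (trans (Σℤ²-basicMove i i′ j j′ w) (vanishes sameSide))
    where
    w : Fin R → Fin C → ℤ
    w k l = 𝟙 (S k l)
    vanishes : rowSide i ≡ rowSide i′ ⊎ colSide j ≡ colSide j′ →
      (w i j - w i j′) - (w i′ j - w i′ j′) ≡ 0ℤ
    vanishes (inj₁ same-row) =
      trans (cong₂ (λ x y → (x - y) - (w i′ j - w i′ j′)) (same j) (same j′))
            (+-inverseʳ (w i′ j - w i′ j′))
      where
      same : ∀ l → w i l ≡ w i′ l
      same l = cong 𝟙 (trans (S≡sameSide i l)
                 (trans (cong (_≡ᵇ colSide l) same-row) (sym (S≡sameSide i′ l))))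
    vanishes (inj₂ same-col) =
      trans (cong₂ (λ x y → (x - w i j′) - (y - w i′ j′)) (same i) (same i′))
            (cong₂ _-_ (+-inverseʳ (w i j′)) (+-inverseʳ (w i′ j′)))
      where
      same : ∀ k → w k j ≡ w k j′
      same k = cong 𝟙 (trans (S≡sameSide k j)
                 (trans (cong (rowSide k ≡ᵇ_) same-col) (sym (S≡sameSide k j′))))

sideSum : (Fin n → Bool) → Bool → (Fin n → ℤ) → ℤ
sideSum s P v = Σℤ (λ k → 𝟙 (s k ≡ᵇ P) * v k)

module _ (s : Fin n → Bool) (P : Bool) where

  sideSum-cong : {v w : Fin n → ℤ} → (∀ k → v k ≡ w k) → sideSum s P v ≡ sideSum s P w
  sideSum-cong v≗w = Σℤ-cong (λ k → cong (𝟙 (s k ≡ᵇ P) *_) (v≗w k))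

  sideSum-⊕ : (v w : Fin n → ℤ) → sideSum s P (λ k → v k + w k) ≡ sideSum s P v + sideSum s P w
  sideSum-⊕ v w = trans (Σℤ-cong (λ k → *-distribˡ-+ (𝟙 (s k ≡ᵇ P)) (v k) (w k)))
                        (Σℤ-distrib-+ (λ k → 𝟙 (s k ≡ᵇ P) * v k) _)

  sideSum-zero : {v : Fin n → ℤ} → (∀ k → v k ≡ 0ℤ) → sideSum s P v ≡ 0ℤ
  sideSum-zero v≗0 =
    trans (Σℤ-cong (λ k → trans (cong (𝟙 (s k ≡ᵇ P) *_) (v≗0 k)) (*-zeroʳ (𝟙 (s k ≡ᵇ P)))))
          (Σℤ-zero n)

  private
    on-side : ∀ {t} → s t ≡ P → ∀ x → 𝟙 (s t ≡ᵇ P) * x ≡ x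
    on-side refl x = trans (cong (λ b → 𝟙 b * x) (≡ᵇ-refl P)) (*-identityˡ x)

    pos-on-side : ∀ {t x} → 0ℤ < 𝟙 (s t ≡ᵇ P) * x → s t ≡ P × 0ℤ < x
    pos-on-side {t} {x} = map₁ (≡ᵇ⇒≡ (s t) P) ∘ 𝟙*-pos (s t ≡ᵇ P) x

    neg-on-side : ∀ {t x} → 𝟙 (s t ≡ᵇ P) * x < 0ℤ → s t ≡ P × x < 0ℤ
    neg-on-side {t} {x} = map₁ (≡ᵇ⇒≡ (s t) P) ∘ 𝟙*-neg (s t ≡ᵇ P) x

  positive-on-side : (v : Fin n → ℤ) → 0ℤ < sideSum s P v → ∃ λ k → s k ≡ P × 0ℤ < v k
  positive-on-side v 0<Σ with positive-term (λ k → 𝟙 (s k ≡ᵇ P) * v k) 0<Σ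
  ... | k , 0<𝟙v = k , pos-on-side 0<𝟙v

  positive-on-side-of-zero : (v : Fin n → ℤ) → sideSum s P v ≡ 0ℤ →
    ∀ t → s t ≡ P → v t < 0ℤ → ∃ λ k → s k ≡ P × 0ℤ < v k
  positive-on-side-of-zero v Σ≡0 t st≡P vt<0
    with positive-term-of-zero-sum (λ k → 𝟙 (s k ≡ᵇ P) * v k) Σ≡0 t
           (subst (_< 0ℤ) (sym (on-side st≡P (v t))) vt<0)
  ... | k , 0<𝟙v = k , pos-on-side 0<𝟙v

  negative-on-side-of-zero : (v : Fin n → ℤ) → sideSum s P v ≡ 0ℤ →
    ∀ t → s t ≡ P → 0ℤ < v t → ∃ λ k → s k ≡ P × v k < 0ℤ
  negative-on-side-of-zero v Σ≡0 t st≡P 0<vt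
    with negative-term-of-zero-sum (λ k → 𝟙 (s k ≡ᵇ P) * v k) Σ≡0 t
           (subst (0ℤ <_) (sym (on-side st≡P (v t))) 0<vt)
  ... | k , 𝟙v<0 = k , neg-on-side 𝟙v<0

  opposite-on-side : (v : Fin n → ℤ) → sideSum s P v ≡ 0ℤ → ∀ t → s t ≡ P → v t ≢ 0ℤ →
    ∃₂ λ i i′ → s i ≡ P × s i′ ≡ P × 0ℤ < v i × v i′ < 0ℤ
  opposite-on-side v Σ≡0 t st≡P vt≢0 with <-cmp (v t) 0ℤ
  ... | tri< vt<0 _ _ with positive-on-side-of-zero v Σ≡0 t st≡P vt<0
  ...   | i , si≡P , 0<vi = i , t , si≡P , st≡P , 0<vi , vt<0
  opposite-on-side v Σ≡0 t st≡P vt≢0 | tri≈ _ vt≡0 _ = ⊥-elim (vt≢0 vt≡0)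
  opposite-on-side v Σ≡0 t st≡P vt≢0 | tri> _ _ 0<vt with negative-on-side-of-zero v Σ≡0 t st≡P 0<vt
  ...   | i′ , si′≡P , vi′<0 = t , i′ , st≡P , si′≡P , 0<vt , vi′<0

sideSum-partition : (s : Fin n → Bool) (v : Fin n → ℤ) → sideSum s true v + sideSum s false v ≡ Σℤ v
sideSum-partition s v =
  trans (sym (Σℤ-distrib-+ (λ k → 𝟙 (s k ≡ᵇ true) * v k) _)) (Σℤ-cong (λ k → split (s k) (v k)))
  where
  split : ∀ b x → 𝟙 (b ≡ᵇ true) * x + 𝟙 (b ≡ᵇ false) * x ≡ x
  split true  x = trans (+-identityʳ _) (*-identityˡ x)
  split false x = trans (+-identityˡ _) (*-identityˡ x)

sideSum-complement : (s : Fin n → Bool) (v : Fin n → ℤ) → Σℤ v ≡ 0ℤ →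
  sideSum s false v ≡ - sideSum s true v
sideSum-complement s v Σv≡0 = begin
  sideSum s false v            ≡⟨ add-sub (sideSum s true v) (sideSum s false v) ⟩
  (x + sideSum s false v) - x  ≡⟨ cong (_- x) (trans (sideSum-partition s v) Σv≡0) ⟩
  0ℤ - x                       ≡⟨ +-identityˡ (- x) ⟩
  - x                          ∎
  where
  open ≡-Reasoning
  x = sideSum s true v
  add-sub : ∀ x y → y ≡ (x + y) - x
  add-sub = solve-∀

sideSum-vanishes : (s : Fin n → Bool) (v : Fin n → ℤ) → Σℤ v ≡ 0ℤ → sideSum s true v ≡ 0ℤ →
  ∀ P → sideSum s P v ≡ 0ℤ
sideSum-vanishes s v Σv≡0 true-side≡0 true  = true-side≡0
sideSum-vanishes s v Σv≡0 true-side≡0 false =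
  trans (sideSum-complement s v Σv≡0) (cong -_ true-side≡0)

blockSum : (Fin R → Bool) → (Fin C → Bool) → Array R C → Bool → Bool → ℤ
blockSum a b E P Q = sideSum a P (λ k → sideSum b Q (E k))

module _ (a : Fin R → Bool) (b : Fin C → Bool) (E : Array R C) where

  blockSum-transpose : ∀ P Q → blockSum b a (transpose E) Q P ≡ blockSum a b E P Q
  blockSum-transpose P Q = begin
    Σℤ (λ l → 𝟙b l * Σℤ (λ k → 𝟙a k * E k l))
      ≡⟨ Σℤ-cong (λ l → *-distribˡ-Σℤ (𝟙b l) (λ k → 𝟙a k * E k l)) ⟩
    Σℤ (λ l → Σℤ (λ k → 𝟙b l * (𝟙a k * E k l)))
      ≡⟨ sym (Σℤ-comm (λ k l → 𝟙b l * (𝟙a k * E k l))) ⟩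
    Σℤ (λ k → Σℤ (λ l → 𝟙b l * (𝟙a k * E k l)))
      ≡⟨ Σℤ-cong (λ k → Σℤ-cong (λ l → swap (𝟙b l) (𝟙a k) (E k l))) ⟩
    Σℤ (λ k → Σℤ (λ l → 𝟙a k * (𝟙b l * E k l)))
      ≡⟨ Σℤ-cong (λ k → sym (*-distribˡ-Σℤ (𝟙a k) (λ l → 𝟙b l * E k l))) ⟩
    Σℤ (λ k → 𝟙a k * Σℤ (λ l → 𝟙b l * E k l)) ∎
    where
    open ≡-Reasoning
    𝟙a = λ k → 𝟙 (a k ≡ᵇ P)
    𝟙b = λ l → 𝟙 (b l ≡ᵇ Q)
    swap : ∀ x y z → x * (y * z) ≡ y * (x * z)
    swap = solve-∀

  blockSum-rows : (∀ k → rowSum E k ≡ 0ℤ) →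
    ∀ P → blockSum a b E P true + blockSum a b E P false ≡ 0ℤ
  blockSum-rows rows P = begin
    blockSum a b E P true + blockSum a b E P false
      ≡⟨ sym (sideSum-⊕ a P (λ k → sideSum b true (E k)) (λ k → sideSum b false (E k))) ⟩
    sideSum a P (λ k → sideSum b true (E k) + sideSum b false (E k))
      ≡⟨ sideSum-zero a P (λ k → trans (sideSum-partition b (E k)) (rows k)) ⟩
    0ℤ ∎
    where open ≡-Reasoning

blockSum-diagonal : {S : Subset R C} (L : BlockLabelling S) (E : Array R C) →
  let open BlockLabelling L in
  sumOver S E ≡ blockSum rowSide colSide E true true + blockSum rowSide colSide E false false
blockSum-diagonal {S = S} L E =
  trans (Σℤ-cong row) (Σℤ-distrib-+ (λ k → 𝟙a true k * sideSum colSide true (E k)) _)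
  where
  open BlockLabelling L
  𝟙a = λ P k → 𝟙 (rowSide k ≡ᵇ P)
  𝟙b = λ Q l → 𝟙 (colSide l ≡ᵇ Q)
  𝟙-≡ᵇ : ∀ x y → 𝟙 (x ≡ᵇ y) ≡ 𝟙 (x ≡ᵇ true) * 𝟙 (y ≡ᵇ true) + 𝟙 (x ≡ᵇ false) * 𝟙 (y ≡ᵇ false)
  𝟙-≡ᵇ true  true  = refl
  𝟙-≡ᵇ true  false = refl
  𝟙-≡ᵇ false true  = refl
  𝟙-≡ᵇ false false = refl
  expand : ∀ a b c d x → (a * b + c * d) * x ≡ a * (b * x) + c * (d * x)
  expand = solve-∀
  cell : ∀ k l → (if S k l then E k l else 0ℤ) ≡
                 𝟙a true k * (𝟙b true l * E k l) + 𝟙a false k * (𝟙b false l * E k l)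
  cell k l = begin
    (if S k l then E k l else 0ℤ)
      ≡⟨ if-then-0≡𝟙* (S k l) (E k l) ⟩
    𝟙 (S k l) * E k l
      ≡⟨ cong (λ s → 𝟙 s * E k l) (S≡sameSide k l) ⟩
    𝟙 (rowSide k ≡ᵇ colSide l) * E k l
      ≡⟨ cong (_* E k l) (𝟙-≡ᵇ (rowSide k) (colSide l)) ⟩
    (𝟙a true k * 𝟙b true l + 𝟙a false k * 𝟙b false l) * E k l
      ≡⟨ expand (𝟙a true k) (𝟙b true l) (𝟙a false k) (𝟙b false l) (E k l) ⟩
    𝟙a true k * (𝟙b true l * E k l) + 𝟙a false k * (𝟙b false l * E k l) ∎
    where open ≡-Reasoning
  row : ∀ k → Σℤ (λ l → if S k l then E k l else 0ℤ) ≡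
              𝟙a true k * sideSum colSide true (E k) + 𝟙a false k * sideSum colSide false (E k)
  row k = trans (Σℤ-cong (cell k))
    (trans (Σℤ-distrib-+ (λ l → 𝟙a true k * (𝟙b true l * E k l)) _)
           (sym (cong₂ _+_ (*-distribˡ-Σℤ (𝟙a true k) (λ l → 𝟙b true l * E k l))
                           (*-distribˡ-Σℤ (𝟙a false k) (λ l → 𝟙b false l * E k l)))))

record Balanced (a : Fin R → Bool) (b : Fin C → Bool) (E : Array R C) : Set where
  field
    rows   : ∀ k → rowSum E k ≡ 0ℤ
    cols   : ∀ l → colSum E l ≡ 0ℤ
    blocks : ∀ P Q → blockSum a b E P Q ≡ 0ℤ

Balanced-transpose : ∀ {a : Fin R → Bool} {b : Fin C → Bool} {E} →
  Balanced a b E → Balanced b a (transpose E)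
Balanced-transpose {a = a} {b} {E} balanced = record
  { rows   = cols
  ; cols   = rows
  ; blocks = λ Q P → trans (blockSum-transpose a b E P Q) (blocks P Q)
  }
  where open Balanced balanced

four-blocks-vanish : ∀ {tt tf ft ff : ℤ} →
  tt + tf ≡ 0ℤ → ft + ff ≡ 0ℤ → tf + ff ≡ 0ℤ → tt + ff ≡ 0ℤ →
  tt ≡ 0ℤ × tf ≡ 0ℤ × ft ≡ 0ℤ × ff ≡ 0ℤ
four-blocks-vanish {tt} {tf} {ft} {ff} row-t row-f col-f diag =
  tt≡0 , cancel tt≡0 row-t , cancel ff≡0 (trans (+-comm ff ft) row-f) , ff≡0
  where
  tt≡0 : tt ≡ 0ℤ
  tt≡0 = *-cancelˡ-≡ (+ 2) tt 0ℤ (begin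
    + 2 * tt                           ≡⟨ combine tt tf ff ⟩
    (tt + tf) - (tf + ff) + (tt + ff)  ≡⟨ cong₂ _+_ (cong₂ _-_ row-t col-f) diag ⟩
    0ℤ                                 ∎)
    where
    open ≡-Reasoning
    combine : ∀ x y z → + 2 * x ≡ (x + y) - (y + z) + (x + z)
    combine = solve-∀
  cancel : ∀ {x y} → x ≡ 0ℤ → x + y ≡ 0ℤ → y ≡ 0ℤ
  cancel refl x+y≡0 = trans (sym (+-identityˡ _)) x+y≡0
  ff≡0 = cancel tt≡0 diag

IsMove⇒Balanced : {S : Subset R C} (L : BlockLabelling S) {E : Array R C} → IsMove S E →
  let open BlockLabelling L in Balanced rowSide colSide E
IsMove⇒Balanced {S = S} L {E} (rows , cols , diag) =
  record { rows = rows ; cols = cols ; blocks = blocks }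
  where
  open BlockLabelling L renaming (rowSide to a; colSide to b)
  col-f : blockSum a b E true false + blockSum a b E false false ≡ 0ℤ
  col-f = trans (cong₂ _+_ (sym (blockSum-transpose a b E true false))
                           (sym (blockSum-transpose a b E false false)))
                (blockSum-rows b a (transpose E) cols false)
  vanish = four-blocks-vanish (blockSum-rows a b E rows true) (blockSum-rows a b E rows false)
                              col-f (trans (sym (blockSum-diagonal L E)) diag)
  blocks : ∀ P Q → blockSum a b E P Q ≡ 0ℤ
  blocks true  true  = proj₁ vanish
  blocks true  false = proj₁ (proj₂ vanish)
  blocks false true  = proj₁ (proj₂ (proj₂ vanish))
  blocks false false = proj₂ (proj₂ (proj₂ vanish))

-- The potential and its descent

imbalance : (Fin C → Bool) → Array R C → ℤ
imbalance b E = ∥ (λ k → sideSum b true (E k)) ∥₁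

ℓ¹ : Array R C → ℤ
ℓ¹ E = Σℤ (λ k → ∥ E k ∥₁)

potential : (Fin R → Bool) → (Fin C → Bool) → Array R C → ℤ
potential a b E = imbalance b E + imbalance a (transpose E) + ℓ¹ E

module _ (a : Fin R → Bool) (b : Fin C → Bool) where

  potential-nonneg : (E : Array R C) → 0ℤ ≤ potential a b E
  potential-nonneg E =
    +-mono-≤ (+-mono-≤ (∥∥₁-nonneg (λ k → sideSum b true (E k)))
                       (∥∥₁-nonneg (λ l → sideSum a true (transpose E l))))
             (Σℤ-nonneg {f = λ k → ∥ E k ∥₁} (λ k → ∥∥₁-nonneg (E k)))

  potential-cong : {E F : Array R C} → E ≋ F → potential a b E ≡ potential a b F
  potential-cong E≋F = cong₂ _+_
    (cong₂ _+_ (∥∥₁-cong (λ k → sideSum-cong b true (E≋F k)))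
               (∥∥₁-cong (λ l → sideSum-cong a true (λ k → E≋F k l))))
    (Σℤ-cong (λ k → ∥∥₁-cong (E≋F k)))

  potential-transpose : (E : Array R C) → potential a b E ≡ potential b a (transpose E)
  potential-transpose E = cong₂ _+_ (+-comm (imbalance b E) (imbalance a (transpose E)))
                                    (Σℤ-comm (λ k l → + ∣ E k l ∣))

imbalance-⊕ : (b : Fin C → Bool) (E M : Array R C) →
  imbalance b (E ⊕ M) ≡ ∥ (λ k → sideSum b true (E k) + sideSum b true (M k)) ∥₁
imbalance-⊕ b E M = ∥∥₁-cong (λ k → sideSum-⊕ b true (E k) (M k))

imbalance-⊕-invariant : (b : Fin C → Bool) (E M : Array R C) → (∀ k → sideSum b true (M k) ≡ 0ℤ) →
  imbalance b (E ⊕ M) ≡ imbalance b E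
imbalance-⊕-invariant b E M M-balanced = trans (imbalance-⊕ b E M) (∥∥₁-cong adds-zero)
  where
  adds-zero : ∀ k → sideSum b true (E k) + sideSum b true (M k) ≡ sideSum b true (E k)
  adds-zero k = trans (cong (_+_ (sideSum b true (E k))) (M-balanced k)) (+-identityʳ _)

*-difference-vanishes : ∀ d {x y} → x ≡ y → d * (x - y) ≡ 0ℤ
*-difference-vanishes d {x} refl = trans (cong (d *_) (+-inverseʳ x)) (*-zeroʳ d)

module _ (i i′ : Fin R) (j j′ : Fin C) where

  basicMove-row-balanced : (b : Fin C → Bool) → b j ≡ b j′ →
    ∀ k → sideSum b true (basicMove i i′ j j′ k) ≡ 0ℤ
  basicMove-row-balanced b bj≡bj′ k =
    trans (Σℤ-basicMove-row i i′ j j′ (λ l → 𝟙 (b l ≡ᵇ true)) k)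
          (*-difference-vanishes (Δ i i′ k) (cong (λ x → 𝟙 (x ≡ᵇ true)) bj≡bj′))

  basicMove-col-balanced : (a : Fin R → Bool) → a i ≡ a i′ →
    ∀ l → sideSum a true (transpose (basicMove i i′ j j′) l) ≡ 0ℤ
  basicMove-col-balanced a ai≡ai′ l =
    trans (Σℤ-basicMove-col i i′ j j′ (λ k → 𝟙 (a k ≡ᵇ true)) l)
          (*-difference-vanishes (Δ j j′ l) (cong (λ x → 𝟙 (x ≡ᵇ true)) ai≡ai′))

  imbalance-decreases : (b : Fin C → Bool) (E : Array R C) → i ≢ i′ → b j ≡ false → b j′ ≡ true →
    0ℤ < sideSum b true (E i) → sideSum b true (E i′) < 0ℤ →
    imbalance b (E ⊕ basicMove i i′ j j′) < imbalance b E
  imbalance-decreases b E i≢i′ bj≡false bj′≡true 0<ri ri′<0 = begin-strict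
    imbalance b (E ⊕ M)
      ≡⟨ imbalance-⊕ b E M ⟩
    ∥ (λ k → r k + sideSum b true (M k)) ∥₁
      ≡⟨ ∥∥₁-cong (λ k → cong (_+_ (r k)) (row-of-M k)) ⟩
    ∥ (λ k → r k + Δ i′ i k) ∥₁
      <⟨ ∥+∥₁-< r (Δ i′ i) (Δ-lowersOnlyPositive r i≢i′ 0<ri) (Σℤ-Δ-zero i′ i)
                i′ ri′<0 (Δ-at-source (i≢i′ ∘ sym)) ⟩
    ∥ r ∥₁ ∎
    where
    open ≤-Reasoning
    M = basicMove i i′ j j′
    r = λ k → sideSum b true (E k)
    flip : ∀ x y → (x - y) * (0ℤ - 1ℤ) ≡ y - x
    flip = solve-∀
    row-of-M : ∀ k → sideSum b true (M k) ≡ Δ i′ i k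
    row-of-M k = trans (Σℤ-basicMove-row i i′ j j′ (λ l → 𝟙 (b l ≡ᵇ true)) k)
      (trans (cong₂ (λ x y → Δ i i′ k * (𝟙 (x ≡ᵇ true) - 𝟙 (y ≡ᵇ true))) bj≡false bj′≡true)
             (flip (δ k i) (δ k i′)))

ℓ¹-⊕-≤ : (E M : Array R C) → (∀ k l → LowersOnlyPositive (E k l) (M k l)) →
  (∀ k → rowSum M k ≡ 0ℤ) → ℓ¹ (E ⊕ M) ≤ ℓ¹ E
ℓ¹-⊕-≤ E M lowers rows = Σℤ-mono-≤ (λ k → ∥+∥₁-≤ (E k) (M k) (lowers k) (rows k))

ℓ¹-⊕-< : (E M : Array R C) → (∀ k l → LowersOnlyPositive (E k l) (M k l)) →
  (∀ k → rowSum M k ≡ 0ℤ) → ∀ t u → E t u < 0ℤ → M t u ≡ 1ℤ → ℓ¹ (E ⊕ M) < ℓ¹ E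
ℓ¹-⊕-< E M lowers rows t u Etu<0 Mtu≡1 =
  Σℤ-mono-< (λ k → ∥+∥₁-≤ (E k) (M k) (lowers k) (rows k)) t
            (∥+∥₁-< (E t) (M t) (lowers t) (rows t) u Etu<0 Mtu≡1)

record Improvement (a : Fin R → Bool) (b : Fin C → Bool) (E : Array R C) : Set where
  field
    i i′      : Fin R
    j j′      : Fin C
    i≢i′      : i ≢ i′
    j≢j′      : j ≢ j′
    sameSide  : a i ≡ a i′ ⊎ b j ≡ b j′
    0<Eij′    : 0ℤ < E i j′
    0<Ei′j    : 0ℤ < E i′ j
    decreases : potential a b (E ⊕ basicMove i i′ j j′) < potential a b E

module _ (a : Fin R → Bool) (b : Fin C → Bool) (E : Array R C) (balanced : Balanced a b E) where
  open Balanced balanced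

  improvement-by-rows : ∀ t → sideSum b true (E t) ≢ 0ℤ → Improvement a b E
  improvement-by-rows t rt≢0
    with opposite-on-side a (a t) (λ k → sideSum b true (E k)) (blocks (a t) true) t refl rt≢0
  ... | i , i′ , ai≡at , ai′≡at , 0<ri , ri′<0
    with positive-on-side b true (E i) 0<ri
       | positive-on-side b false (E i′)
           (subst (0ℤ <_) (sym (sideSum-complement b (E i′) (rows i′))) (neg-mono-< ri′<0))
  ... | j′ , bj′≡true , 0<Eij′ | j , bj≡false , 0<Ei′j = record
    { i≢i′      = i≢i′
    ; j≢j′      = j≢j′
    ; sameSide  = inj₁ ai≡ai′
    ; 0<Eij′    = 0<Eij′
    ; 0<Ei′j    = 0<Ei′j
    ; decreases = +-mono-<-≤
        (+-mono-<-≤ (imbalance-decreases i i′ j j′ b E i≢i′ bj≡false bj′≡true 0<ri ri′<0)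
                    (≤-reflexive (imbalance-⊕-invariant a (transpose E) (transpose M)
                                   (basicMove-col-balanced i i′ j j′ a ai≡ai′))))
        (ℓ¹-⊕-≤ E M (basicMove-lowersOnlyPositive E i i′ j j′ i≢i′ j≢j′ 0<Eij′ 0<Ei′j)
                    (rowSum-basicMove i i′ j j′))
    }
    where
    M = basicMove i i′ j j′
    ai≡ai′ = trans ai≡at (sym ai′≡at)
    i≢i′ : i ≢ i′
    i≢i′ refl = <-asym 0<ri ri′<0
    j≢j′ : j ≢ j′
    j≢j′ j≡j′ = not-¬ bj≡false (trans (cong b j≡j′) bj′≡true)

  negative-entry : ∀ k l → E k l ≢ 0ℤ → ∃₂ λ i j → E i j < 0ℤ
  negative-entry k l Ekl≢0 with <-cmp (E k l) 0ℤ
  ... | tri< Ekl<0 _ _ = k , l , Ekl<0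
  ... | tri≈ _ Ekl≡0 _ = ⊥-elim (Ekl≢0 Ekl≡0)
  ... | tri> _ _ 0<Ekl = k , negative-term-of-zero-sum (E k) (rows k) l 0<Ekl

  improvement-within-sides : (∀ k → sideSum b true (E k) ≡ 0ℤ) →
    (∀ l → sideSum a true (transpose E l) ≡ 0ℤ) → ∀ k l → E k l ≢ 0ℤ → Improvement a b E
  improvement-within-sides rows-even cols-even k l Ekl≢0 with negative-entry k l Ekl≢0
  ... | i , j , Eij<0
    with positive-on-side-of-zero b (b j) (E i)
           (sideSum-vanishes b (E i) (rows i) (rows-even i) (b j)) j refl Eij<0
       | positive-on-side-of-zero a (a i) (transpose E j)
           (sideSum-vanishes a (transpose E j) (cols j) (cols-even j) (a i)) i refl Eij<0
  ... | j′ , bj′≡bj , 0<Eij′ | i′ , ai′≡ai , 0<Ei′j = record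
    { i≢i′      = i≢i′
    ; j≢j′      = j≢j′
    ; sameSide  = inj₁ (sym ai′≡ai)
    ; 0<Eij′    = 0<Eij′
    ; 0<Ei′j    = 0<Ei′j
    ; decreases = +-mono-≤-<
        (≤-reflexive (cong₂ _+_
          (imbalance-⊕-invariant b E M (basicMove-row-balanced i i′ j j′ b (sym bj′≡bj)))
          (imbalance-⊕-invariant a (transpose E) (transpose M)
            (basicMove-col-balanced i i′ j j′ a (sym ai′≡ai)))))
        (ℓ¹-⊕-< E M (basicMove-lowersOnlyPositive E i i′ j j′ i≢i′ j≢j′ 0<Eij′ 0<Ei′j)
                    (rowSum-basicMove i i′ j j′)
                    i j Eij<0 (basicMove-at-source i i′ j j′ i≢i′ j≢j′))
    }
    where
    M = basicMove i i′ j j′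
    i≢i′ : i ≢ i′
    i≢i′ refl = <-asym Eij<0 0<Ei′j
    j≢j′ : j ≢ j′
    j≢j′ refl = <-asym Eij<0 0<Eij′

Improvement-transpose : ∀ {a : Fin R → Bool} {b : Fin C → Bool} {E} →
  Improvement b a (transpose E) → Improvement a b E
Improvement-transpose {a = a} {b} {E} improvementᵀ = record
  { i≢i′      = j≢j′
  ; j≢j′      = i≢i′
  ; sameSide  = [ inj₂ , inj₁ ]′ sameSide
  ; 0<Eij′    = 0<Ei′j
  ; 0<Ei′j    = 0<Eij′
  ; decreases = begin-strict
      potential a b (E ⊕ basicMove j j′ i i′)
        ≡⟨ potential-transpose a b (E ⊕ basicMove j j′ i i′) ⟩
      potential b a (transpose (E ⊕ basicMove j j′ i i′))
        ≡⟨ potential-cong b a (λ l k → cong (_+_ (E k l))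
                                             (sym (basicMove-transpose i i′ j j′ l k))) ⟩
      potential b a (transpose E ⊕ basicMove i i′ j j′)
        <⟨ decreases ⟩
      potential b a (transpose E)
        ≡⟨ potential-transpose a b E ⟨
      potential a b E ∎
  }
  where
  open Improvement improvementᵀ
  open ≤-Reasoning

improvement : (a : Fin R → Bool) (b : Fin C → Bool) (E : Array R C) → Balanced a b E →
  ∀ k l → E k l ≢ 0ℤ → Improvement a b E
improvement a b E balanced k l Ekl≢0 with all? (λ t → sideSum b true (E t) ≟ℤ 0ℤ)
... | no rows-uneven with ¬∀⟶∃¬ _ _ (λ t → sideSum b true (E t) ≟ℤ 0ℤ) rows-uneven
...   | t , rt≢0 = improvement-by-rows a b E balanced t rt≢0
improvement a b E balanced k l Ekl≢0 | yes rows-even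
  with all? (λ t → sideSum a true (transpose E t) ≟ℤ 0ℤ)
... | no cols-uneven with ¬∀⟶∃¬ _ _ (λ t → sideSum a true (transpose E t) ≟ℤ 0ℤ) cols-uneven
...   | t , ct≢0 = Improvement-transpose
                     (improvement-by-rows b a (transpose E) (Balanced-transpose balanced) t ct≢0)
improvement a b E balanced k l Ekl≢0 | yes rows-even | yes cols-even =
  improvement-within-sides a b E balanced rows-even cols-even k l Ekl≢0

module _ {S : Subset R C} (L : BlockLabelling S) where
  open BlockLabelling L

  distance : Table R C → Table R C → ℕ
  distance Y X = ∣ potential rowSide colSide (difference X Y) ∣

  basicMove-descent : ∀ Y X → SameFiber S X Y → ∀ k l → X k l ≢ Y k l →
    Σ (Array R C) λ M → Σ (Table R C) λ Z →
      B₀ S M × IsMove S M × toArray Z ≋ (toArray X ⊕ M) × distance Y Z ℕ.< distance Y X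
  basicMove-descent Y X X~Y k l Xkl≢Ykl =
    M , Z , ((i , i′ , j , j′ , i≢i′ , j≢j′ , λ _ _ → refl) , isMove) , isMove , Z≋X⊕M ,
    0≤i<j⇒∣i∣<∣j∣ (potential-nonneg rowSide colSide (difference Z Y)) (begin-strict
      potential rowSide colSide (difference Z Y) ≡⟨ potential-cong rowSide colSide Z-Y≋D⊕M ⟩
      potential rowSide colSide (D ⊕ M)          <⟨ decreases ⟩
      potential rowSide colSide D                ∎)
    where
    open ≤-Reasoning
    D = difference X Y
    open Improvement
      (improvement rowSide colSide D (IsMove⇒Balanced L (SameFiber⇒IsMove-difference S X~Y)) k l
                   (Xkl≢Ykl ∘ +-injective ∘ i-j≡0⇒i≡j _ _))
    M = basicMove i i′ j j′
    isMove = basicMove-isMove L i i′ j j′ sameSide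
    Z : Table R C
    Z k l = ∣ + X k l + M k l ∣
    Z≋X⊕M : toArray Z ≋ (toArray X ⊕ M)
    Z≋X⊕M k l = 0≤i⇒+∣i∣≡i (LowersOnlyPositive-nonneg (+≤+ z≤n)
      (LowersOnlyPositive-mono (i-j≤i (+ X k l) (+ Y k l))
        (basicMove-lowersOnlyPositive D i i′ j j′ i≢i′ j≢j′ 0<Eij′ 0<Ei′j k l)))
    Z-Y≋D⊕M : difference Z Y ≋ (D ⊕ M)
    Z-Y≋D⊕M k l = trans (cong (_- + Y k l) (Z≋X⊕M k l)) (reorder (+ X k l) (M k l) (+ Y k l))
      where
      reorder : ∀ x m y → (x + m) - y ≡ (x - y) + m
      reorder = solve-∀

proposition3 : (R C : ℕ) → .{{_ : NonZero R}} → .{{_ : NonZero C}} →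
    (S : Subset R C) → Nonempty S → Proper S → Block2x2 S →
    MarkovBasis S (B₀ S)
proposition3 R C S _ _ block2x2 =
  B₀-finite S , (λ _ → proj₂) , B₀-neg S ,
  λ X Y X~Y → connects-by-descent S (B₀ S) Y (distance L Y) (basicMove-descent L Y) X X~Y
  where
  L = block2x2⇒labelling block2x2
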